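{- Let $\mathcal P$ be a set of $n$ points in $\mathbb C^2$. Then there are $O(n^3)$ pairs of parallel lines in $\mathcal L(\mathcal P)$.
   Context: For $a=(a_x,a_y),c=(c_x,c_y)\in\mathbb C^2$, $\ell_{a,c}$ is the line in $\mathbb C^3$ defined by $2x=(a_x+c_x)+(a_y-c_y)z$ and $2y=(a_y+c_y)+(c_x-a_x)z$, and $\mathcal L(\mathcal P)=\{\ell_{a,c}:(a,c)\in\mathcal P^2\}$. -}

module Defs where

open import Level using (Level; _⊔_) renaming (suc to lsuc)
open import Algebra.Bundles using (CommutativeRing)
open import Data.Nat using (ℕ; zero; suc; _≤_)
open import Relation.Binary.PropositionalEquality using (_≡_)
open import Data.Fin using (Fin)
open import Data.List using (List; []; _∷_; length)
open import Data.List.Relation.Unary.AllPairs using (AllPairs)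
open import Data.List.Relation.Unary.All using (All)
open import Data.Product using (Σ; _×_; _,_; ∃; ∃-syntax)
open import Data.Sum using (_⊎_)
open import Relation.Nullary using (¬_)
open import Function.Bundles using (_⇔_)

module _ {c ℓ : Level} (R : CommutativeRing c ℓ) where
  open CommutativeRing R

  natCast : ℕ → Carrier
  natCast zero    = 0#
  natCast (suc n) = 1# + natCast n

  -- the monic polynomial x^k + c_{k-1} x^{k-1} + ... + c_0 , cs = [c_0 , ... , c_{k-1}]
  monic : List Carrier → Carrier → Carrier
  monic []       x = 1#
  monic (a ∷ cs) x = a + x * monic cs x

-- An abstract stand-in for the complex numbers: an algebraically closed
-- field of characteristic 0 (any such field is elementarily equivalent to ℂ).
record ComplexLike (c ℓ : Level) : Set (lsuc (c ⊔ ℓ)) where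
  field
    cring : CommutativeRing c ℓ
  open CommutativeRing cring public
  field
    1≉0        : ¬ (1# ≈ 0#)
    inverse    : ∀ x → ¬ (x ≈ 0#) → ∃[ y ] (x * y ≈ 1#)
    char0      : ∀ n → ¬ (natCast cring (suc n) ≈ 0#)
    algClosed  : ∀ (cs : List Carrier) → 1 ≤ length cs → ∃[ x ] (monic cring cs x ≈ 0#)

module _ {c ℓ : Level} (K : ComplexLike c ℓ) where
  open ComplexLike K

  Point2 : Set c
  Point2 = Carrier × Carrier

  Point3 : Set c
  Point3 = Carrier × Carrier × Carrier

  _≈₂_ : Point2 → Point2 → Set ℓ
  (x , y) ≈₂ (x' , y') = (x ≈ x') × (y ≈ y')

  two : Carrier
  two = 1# + 1#

  OnLine : Point2 → Point2 → Point3 → Set ℓ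
  OnLine (ax , ay) (cx , cy) (x , y , z) =
    (two * x ≈ (ax + cx) + (ay - cy) * z) × (two * y ≈ (ay + cy) + (cx - ax) * z)

  -- a line ℓ_{a,c} is represented by its parameters (a , c)
  LineParam : Set c
  LineParam = Point2 × Point2

  OnL : LineParam → Point3 → Set ℓ
  OnL (a , b) = OnLine a b

  SameLine : LineParam → LineParam → Set (c ⊔ ℓ)
  SameLine l m = ∀ p → OnL l p ⇔ OnL m p

  _+₃_ : Point3 → Point3 → Point3
  (x , y , z) +₃ (u , v , w) = (x + u , y + v , z + w)

  Parallel : LineParam → LineParam → Set (c ⊔ ℓ)
  Parallel l m = ¬ SameLine l m × ∃[ v ] (∀ p → OnL l p ⇔ OnL m (p +₃ v))

  SamePair : LineParam × LineParam → LineParam × LineParam → Set (c ⊔ ℓ)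
  SamePair (l₁ , l₂) (m₁ , m₂) =
    (SameLine l₁ m₁ × SameLine l₂ m₂) ⊎ (SameLine l₁ m₂ × SameLine l₂ m₁)

  -- a set of n points in K²: an injective map Fin n → K²
  PointSet : ℕ → Set (c ⊔ ℓ)
  PointSet n = Σ (Fin n → Point2) λ P → (∀ (i j : Fin n) → P i ≈₂ P j → i ≡ j)

  lineOf : ∀ {n} → (Fin n → Point2) → Fin n × Fin n → LineParam
  lineOf P (i , j) = (P i , P j)

  ParallelPairFamily : ∀ {n} → (Fin n → Point2) →
                       List ((Fin n × Fin n) × (Fin n × Fin n)) → Set (c ⊔ ℓ)
  ParallelPairFamily P ps =
    All (λ { (u , v) → Parallel (lineOf P u) (lineOf P v) }) ps ×
    AllPairs (λ { (u , v) (u' , v') →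
                  ¬ SamePair (lineOf P u , lineOf P v) (lineOf P u' , lineOf P v') }) ps

-- Parallel lines have the same direction, and the direction of ℓ_{a,c} is
-- (a_y − c_y, c_x − a_x, 2).  So if ℓ_{a,c} ∥ ℓ_{a',c'}, the point c' is
-- determined by a, c and a'.  A family of pairwise distinct parallel pairs
-- of lines of 𝓛(𝓟) is therefore injectively labelled by triples of points
-- of 𝓟, and has at most n³ members.
module Submission where

open import Defs
open import Level using (Level)
open import Data.Nat using (ℕ; _≤_; _*_; _^_)
open import Data.List using (length)
open import Data.Product using (∃-syntax; proj₁)

open import Level using (_⊔_)
open import Data.Empty using (⊥-elim)
open import Data.Fin using (Fin; zero; suc; combine)
open import Data.Fin.Properties using (injective⇒≤; combine-injective)
open import Data.List using (List; lookup)
open import Data.List.Properties using (length-map)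
open import Data.List.Membership.Propositional.Properties using (∈-lookup)
open import Data.List.Relation.Unary.All as All using (All; []; _∷_)
open import Data.List.Relation.Unary.AllPairs using (AllPairs; []; _∷_)
open import Data.List.Relation.Unary.AllPairs.Properties using (map⁺)
open import Data.List.Relation.Unary.Unique.Propositional using (Unique)
import Data.Nat.Properties as ℕ
open import Data.Product using (_×_; _,_; proj₂)
open import Data.Sum using (inj₁)
open import Function.Base using (_on_)
open import Function.Bundles using (Equivalence)
open import Function.Construct.Identity using (⇔-id)
open import Function.Definitions using (Injective)
open import Relation.Binary.PropositionalEquality
  using (_≡_; _≢_; refl; sym; trans; cong; subst)
open import Relation.Nullary using (¬_)
import Algebra.Properties.CommutativeSemigroup as CommutativeSemigroupProperties
import Algebra.Properties.Group as GroupProperties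
import Relation.Binary.Reasoning.Setoid as SetoidReasoning

unique⇒lookup-injective : ∀ {a} {A : Set a} {xs : List A} →
                          Unique xs → Injective _≡_ _≡_ (lookup xs)
unique⇒lookup-injective (_    ∷ _)   {zero}  {zero}  _  = refl
unique⇒lookup-injective (x∉xs ∷ _)   {zero}  {suc j} eq =
  ⊥-elim (All.lookup x∉xs (∈-lookup j) eq)
unique⇒lookup-injective (x∉xs ∷ _)   {suc i} {zero}  eq =
  ⊥-elim (All.lookup x∉xs (∈-lookup i) (sym eq))
unique⇒lookup-injective (_    ∷ xs!) {suc i} {suc j} eq =
  cong suc (unique⇒lookup-injective xs! eq)

unique⇒length≤ : ∀ {m} {xs : List (Fin m)} → Unique xs → length xs ≤ m
unique⇒length≤ xs! = injective⇒≤ (unique⇒lookup-injective xs!)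

labels-distinct⇒length≤ : ∀ {a} {A : Set a} {m} (label : A → Fin m) {xs : List A} →
                             AllPairs (_≢_ on label) xs → length xs ≤ m
labels-distinct⇒length≤ label {xs} distinct =
  subst (_≤ _) (length-map label xs) (unique⇒length≤ (map⁺ distinct))

AllPairs-strengthen : ∀ {a p r s} {A : Set a} {P : A → Set p}
                        {R : A → A → Set r} {S : A → A → Set s} →
                      (∀ {x y} → P x → P y → R x y → S x y) →
                      ∀ {xs} → All P xs → AllPairs R xs → AllPairs S xs
AllPairs-strengthen f []         []           = []
AllPairs-strengthen f (px ∷ pxs) (rxs ∷ rxss) =
  All.zipWith (λ (py , rxy) → f px py rxy) (pxs , rxs) ∷ AllPairs-strengthen f pxs rxss

triple : ∀ {n} → Fin n × Fin n × Fin n → Fin (n * (n * n))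
triple (i , j , k) = combine i (combine j k)

triple-injective : ∀ {n} → Injective _≡_ _≡_ (triple {n})
triple-injective {x = i , j , k} {i' , j' , k'} eq
  with refl , eq' ← combine-injective i _ i' _ eq
  with refl , refl ← combine-injective j k j' k' eq'
  = refl

module LineGeometry {c ℓ : Level} (K : ComplexLike c ℓ) where
  open ComplexLike K renaming (_*_ to _·_; sym to ≈-sym; trans to ≈-trans)
  open CommutativeSemigroupProperties +-commutativeSemigroup
    using (x∙yz≈y∙xz; x∙yz≈yx∙z)
  open GroupProperties +-group using (∙-cancelˡ; ∙-cancelʳ; ⁻¹-injective)
  open SetoidReasoning setoid

  two≉0 : ¬ (two K ≈ 0#)
  two≉0 2≈0 = char0 1 (≈-trans (+-congˡ (+-identityʳ 1#)) 2≈0)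

  half : Carrier
  half = proj₁ (inverse (two K) two≉0)

  two·half·x≈x : ∀ x → two K · (half · x) ≈ x
  two·half·x≈x x = begin
    two K · (half · x) ≈⟨ *-assoc _ _ _ ⟨
    (two K · half) · x ≈⟨ *-congʳ (proj₂ (inverse (two K) two≉0)) ⟩
    1# · x             ≈⟨ *-identityˡ x ⟩
    x                  ∎

  -- ℓ_{a,c} is the set of (x,y,z) with 2(x,y) = offset + z · direction.
  offset direction : LineParam K → Point2 K
  offset    ((ax , ay) , (cx , cy)) = (ax + cx , ay + cy)
  direction ((ax , ay) , (cx , cy)) = (ay - cy , cx - ax)

  pointAt : LineParam K → Carrier → Point3 K
  pointAt l z =
    ( half · (proj₁ (offset l) + proj₁ (direction l) · z)
    , half · (proj₂ (offset l) + proj₂ (direction l) · z)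
    , z)

  pointAt-onLine : ∀ l z → OnL K l (pointAt l z)
  pointAt-onLine ((ax , ay) , (cx , cy)) z = two·half·x≈x _ , two·half·x≈x _

  slope-unique : ∀ {S D S' D' u w} →
                 (∀ z → (S + D · z) + u ≈ S' + D' · (z + w)) → D ≈ D'
  slope-unique {S} {D} {S'} {D'} {u} {w} agree = ∙-cancelʳ (S + u) D D' (begin
    D + (S + u)              ≈⟨ x∙yz≈yx∙z D S u ⟩
    (S + D) + u              ≈⟨ +-congʳ (+-congˡ (*-identityʳ D)) ⟨
    (S + D · 1#) + u         ≈⟨ agree 1# ⟩
    S' + D' · (1# + w)       ≈⟨ +-congˡ (≈-trans (distribˡ D' 1# w) (+-congʳ (*-identityʳ D'))) ⟩
    S' + (D' + D' · w)       ≈⟨ x∙yz≈y∙xz S' D' (D' · w) ⟩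
    D' + (S' + D' · w)       ≈⟨ +-congˡ (+-congˡ (*-congˡ (+-identityˡ w))) ⟨
    D' + (S' + D' · (0# + w)) ≈⟨ +-congˡ (agree 0#) ⟨
    D' + ((S + D · 0#) + u)  ≈⟨ +-congˡ (+-congʳ (≈-trans (+-congˡ (zeroʳ D)) (+-identityʳ S))) ⟩
    D' + (S + u)             ∎)

  translate-preserves-direction :
    ∀ l m v → (∀ p → OnL K l p → OnL K m (_+₃_ K p v)) →
    _≈₂_ K (direction l) (direction m)
  translate-preserves-direction l@((_ , _) , (_ , _)) m@((_ , _) , (_ , _)) v l+v⊆m =
    slope-unique (λ z → undouble (proj₁ (image z))) ,
    slope-unique (λ z → undouble (proj₂ (image z)))
    where
    image : ∀ z → OnL K m (_+₃_ K (pointAt l z) v)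
    image z = l+v⊆m (pointAt l z) (pointAt-onLine l z)
    undouble : ∀ {t s r} → two K · (half · t + s) ≈ r → t + two K · s ≈ r
    undouble {t} eq = ≈-trans (+-congʳ (≈-sym (two·half·x≈x t))) (≈-trans (≈-sym (distribˡ _ _ _)) eq)

  parallel-partner-unique : ∀ {a c a' c' c''} →
    Parallel K (a , c) (a' , c') → Parallel K (a , c) (a' , c'') → _≈₂_ K c' c''
  parallel-partner-unique {a} {c} {a'@(ax' , ay')} {c'} {c''} (_ , v , l∥m) (_ , v' , l∥m') =
    ∙-cancelʳ (- ax') _ _ (≈-trans (≈-sym (proj₂ d)) (proj₂ d')) ,
    ⁻¹-injective (∙-cancelˡ ay' _ _ (≈-trans (≈-sym (proj₁ d)) (proj₁ d')))
    where
    d  = translate-preserves-direction (a , c) (a' , c')  v  (λ p → Equivalence.to (l∥m p))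
    d' = translate-preserves-direction (a , c) (a' , c'') v' (λ p → Equivalence.to (l∥m' p))

module ParallelPairs {c ℓ : Level} (K : ComplexLike c ℓ) {n : ℕ} (𝓟 : PointSet K n) where
  open LineGeometry K using (parallel-partner-unique)

  private
    P : Fin n → Point2 K
    P = proj₁ 𝓟

  IndexPair : Set
  IndexPair = (Fin n × Fin n) × (Fin n × Fin n)

  IsParallelPair : IndexPair → Set (c ⊔ ℓ)
  IsParallelPair (u , v) = Parallel K (lineOf K P u) (lineOf K P v)

  partner-index-unique : ∀ {i j i' j' j''} →
    IsParallelPair ((i , j) , (i' , j')) → IsParallelPair ((i , j) , (i' , j'')) → j' ≡ j''
  partner-index-unique ∥₁ ∥₂ = proj₂ 𝓟 _ _ (parallel-partner-unique ∥₁ ∥₂)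

  -- The fourth index is determined by the other three (partner-index-unique).
  label : IndexPair → Fin (n * (n * n))
  label ((i , j) , (i' , _)) = triple (i , j , i')

  label-separates : ∀ {x y} → IsParallelPair x → IsParallelPair y →
    ¬ SamePair K (lineOf K P (proj₁ x) , lineOf K P (proj₂ x))
                 (lineOf K P (proj₁ y) , lineOf K P (proj₂ y)) →
    label x ≢ label y
  label-separates {(i , j) , (i' , _)} {(k , l) , (k' , _)} ∥₁ ∥₂ different eq
    with refl ← triple-injective {x = i , j , i'} {k , l , k'} eq
    with refl ← partner-index-unique ∥₁ ∥₂
    = different (inj₁ ((λ _ → ⇔-id _) , (λ _ → ⇔-id _)))

lemma7p6 : ∀ {c ℓ : Level} (K : ComplexLike c ℓ) →
    ∃[ C ] (∀ (n : ℕ) (𝓟 : PointSet K n) ps →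
    ParallelPairFamily K (proj₁ 𝓟) ps → length ps ≤ C * n ^ 3)
lemma7p6 K = 1 , λ n 𝓟 ps (parallel , distinct) →
  let open ParallelPairs K 𝓟 in
  ℕ.≤-trans
    (labels-distinct⇒length≤ label (AllPairs-strengthen label-separates parallel distinct))
    (ℕ.≤-reflexive (n*[n*n]≡1*n^3 n))
  where
  n*[n*n]≡1*n^3 : ∀ n → n * (n * n) ≡ 1 * n ^ 3
  n*[n*n]≡1*n^3 n = trans (cong (λ m → n * (n * m)) (sym (ℕ.*-identityʳ n)))
                          (sym (ℕ.*-identityˡ (n ^ 3)))
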